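{- Let $G=(V,E)$ be a graph without isolated vertices, let $\mathcal{R}\subseteq V$, and let $MPD$ be a matched-paired-dominating set of $G$ w.r.t. $\mathcal{R}$. Then: (1) if $|V(MPD)\cap\mathcal{R}|=|\mathcal{R}|$ and $|MPD|=\lceil |\mathcal{R}|/2\rceil$, then $\beta(G)=|\mathcal{R}|$ and $MPD$ is a canonical matched-paired-dominating set of $G$; (2) if $|V|=|\mathcal{R}|$ is odd, $|V(MPD)\cap\mathcal{R}|=|\mathcal{R}|-1$, and $|MPD|=\lfloor |\mathcal{R}|/2\rfloor$, then $\beta(G)=|\mathcal{R}|-1$ and $MPD$ is a canonical matched-paired-dominating set of $G$.
   Context: All graphs are finite, simple and undirected. For a graph $G=(V,E)$ without isolated vertices and $\mathcal{R}\subseteq V$: a set $S\subseteq V$ is a paired-dominating set if every vertex of $V-S$ has a neighbor in $S$ and $G[S]$ has a perfect matching. A set $MPD\subseteq E$ is a matched-paired-dominating set if it is a perfect matching of $G[S]$ for some paired-dominating set $S$; $V(MPD)$ is the set of vertices incident to edges of $MPD$. The matched number of $MPD$ is $|V(MPD)\cap\mathcal{R}|$; $\beta(G)$ is the maximum matched number over all matched-paired-dominating sets; a maximum matched-paired-dominating set has matched number $\beta(G)$. A free-paired-edge of $MPD$ is an edge of $MPD$ with no endpoint in $\mathcal{R}$. A canonical matched-paired-dominating set is a maximum one with the least number of free-paired-edges among all maximum ones. -}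

module Defs where

open import Data.Nat using (ℕ; _≤_)
open import Data.Bool using (Bool; true; false)
open import Data.Fin using (Fin)
open import Data.Fin.Subset using (Subset; _∈_; _∉_)
open import Data.Fin.Subset.Properties using (_∈?_)
open import Data.Product using (_×_; _,_; Σ; ∃; proj₁; proj₂)
open import Data.Sum using (_⊎_)
open import Data.List using (List; []; _∷_; _++_; length; filter; concatMap)
open import Data.List.Membership.Propositional using () renaming (_∈_ to _∈ₗ_)
open import Data.List.Relation.Unary.All using (All)
open import Data.List.Relation.Unary.Unique.Propositional using (Unique)
open import Relation.Binary.PropositionalEquality using (_≡_)
open import Relation.Nullary using (¬_)
open import Relation.Nullary.Decidable using (¬?; _×-dec_)
open import Relation.Nullary using (Dec)

record Graph (n : ℕ) : Set where
  field
    adj   : Fin n → Fin n → Bool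
    sym   : ∀ u v → adj u v ≡ adj v u
    irrefl : ∀ v → adj v v ≡ false

open Graph public

Edge : ∀ {n} → Graph n → Fin n → Fin n → Set
Edge G u v = adj G u v ≡ true

NoIsolated : ∀ {n} → Graph n → Set
NoIsolated {n} G = ∀ (v : Fin n) → ∃ λ u → Edge G v u

-- A set of edges, each edge written as an (unordered) pair of endpoints.
EdgeList : ℕ → Set
EdgeList n = List (Fin n × Fin n)

verts : ∀ {n} → EdgeList n → List (Fin n)
verts = concatMap (λ { (u , v) → u ∷ v ∷ [] })

Dominating : ∀ {n} → Graph n → List (Fin n) → Set
Dominating {n} G S = ∀ (v : Fin n) → ¬ (v ∈ₗ S) → ∃ λ u → (u ∈ₗ S) × Edge G v u

-- M is a matched-paired-dominating set: M is a perfect matching of G[S]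
-- for the paired-dominating set S = V(M). Unfolded: every element of M is
-- an edge of G, the edges of M are pairwise vertex-disjoint (all listed
-- endpoints are distinct, which also excludes repeated edges), and V(M)
-- dominates G.
IsMPD : ∀ {n} → Graph n → EdgeList n → Set
IsMPD G M = All (λ { (u , v) → Edge G u v }) M × Unique (verts M) × Dominating G (verts M)

-- matched number |V(M) ∩ R|  (V(M) has no repetitions for an MPD)
matched : ∀ {n} → Subset n → EdgeList n → ℕ
matched R M = length (filter (_∈? R) (verts M))

isFree? : ∀ {n} (R : Subset n) (e : Fin n × Fin n) → Dec (proj₁ e ∉ R × proj₂ e ∉ R)
isFree? R (u , v) = ¬? (u ∈? R) ×-dec ¬? (v ∈? R)

freeEdges : ∀ {n} → Subset n → EdgeList n → EdgeList n
freeEdges R = filter (isFree? R)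

IsBeta : ∀ {n} → Graph n → Subset n → ℕ → Set
IsBeta G R b = (∃ λ M → IsMPD G M × matched R M ≡ b)
             × (∀ M → IsMPD G M → matched R M ≤ b)

IsMaxMPD : ∀ {n} → Graph n → Subset n → EdgeList n → Set
IsMaxMPD G R M = IsMPD G M × (∀ M' → IsMPD G M' → matched R M' ≤ matched R M)

IsCanonical : ∀ {n} → Graph n → Subset n → EdgeList n → Set
IsCanonical G R M = IsMaxMPD G R M
  × (∀ M' → IsMaxMPD G R M' → length (freeEdges R M) ≤ length (freeEdges R M'))

-- Each edge of an MPD contributes at most 2 to  matched + 2·#free-edges,  so
-- 2·#free + matched ≤ 2|M|; hence an MPD with 2|M| ≤ matched + 1 has no free
-- edges, and is canonical as soon as its matched number is maximal.  Maximality: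
-- V(M′) has no repeated vertex, so matched ≤ |R|; and when V = R with |R| odd,
-- matched ≤ |V(M′)| = 2|M′| ≤ |V| forces matched ≤ |R| − 1.
module Submission where

open import Defs
open import Data.Bool using (true; false)
open import Data.Nat using (ℕ; zero; suc; _+_; _∸_; _≤_; _<_; _%_; ⌈_/2⌉; ⌊_/2⌋; z≤n; s≤s; z<s)
open import Data.Nat.Properties
open import Data.Fin using (Fin)
open import Data.Fin.Subset using (Subset; ∣_∣; _∈_; _-_; ⊤)
open import Data.Fin.Subset.Properties using (_∈?_; x∈p∧x≢y⇒x∈p-y; x∈p⇒∣p-x∣<∣p∣; ∈⊤; ∣⊤∣≡n)
open import Data.Product using (_×_; _,_)
open import Data.List using (List; []; _∷_; length)
open import Data.List.Properties using (length-filter)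
open import Data.List.Relation.Unary.All as All using (All; []; _∷_)
open import Data.List.Relation.Unary.All.Properties using (all-filter)
open import Data.List.Relation.Unary.AllPairs using (_∷_)
open import Data.List.Relation.Unary.Unique.Propositional using (Unique)
import Data.List.Relation.Unary.Unique.Propositional.Properties as Unique
open import Function using (_∘_)
open import Relation.Binary.PropositionalEquality as ≡ using (_≡_; refl; cong; trans; subst)
open import Relation.Nullary using (does; contradiction)

⌈n/2⌉+⌈n/2⌉≤1+n : ∀ n → ⌈ n /2⌉ + ⌈ n /2⌉ ≤ suc n
⌈n/2⌉+⌈n/2⌉≤1+n n = begin
  ⌈ n /2⌉ + ⌈ n /2⌉       ≤⟨ +-monoʳ-≤ ⌈ n /2⌉ (⌈n/2⌉-mono (n≤1+n n)) ⟩
  ⌊ suc n /2⌋ + ⌈ suc n /2⌉ ≡⟨ ⌊n/2⌋+⌈n/2⌉≡n (suc n) ⟩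
  suc n                   ∎
  where open ≤-Reasoning

⌊n/2⌋+⌊n/2⌋≤n : ∀ n → ⌊ n /2⌋ + ⌊ n /2⌋ ≤ n
⌊n/2⌋+⌊n/2⌋≤n n = ≤-trans (+-monoʳ-≤ ⌊ n /2⌋ (⌊n/2⌋≤⌈n/2⌉ n)) (≤-reflexive (⌊n/2⌋+⌈n/2⌉≡n n))

odd⇒≡1+⌊n/2⌋+⌊n/2⌋ : ∀ n → n % 2 ≡ 1 → n ≡ suc (⌊ n /2⌋ + ⌊ n /2⌋)
odd⇒≡1+⌊n/2⌋+⌊n/2⌋ (suc zero)    _   = refl
odd⇒≡1+⌊n/2⌋+⌊n/2⌋ (suc (suc n)) odd =
  cong (suc ∘ suc) (trans (odd⇒≡1+⌊n/2⌋+⌊n/2⌋ n odd) (≡.sym (+-suc ⌊ n /2⌋ ⌊ n /2⌋)))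

m+m≤1+n+n⇒m≤n : ∀ m n → m + m ≤ suc (n + n) → m ≤ n
m+m≤1+n+n⇒m≤n m n m+m≤ = begin
  m               ≡⟨ n≡⌊n+n/2⌋ m ⟩
  ⌊ m + m /2⌋       ≤⟨ ⌊n/2⌋-mono m+m≤ ⟩
  ⌈ n + n /2⌉       ≡⟨ ≡.sym (n≡⌈n+n/2⌉ n) ⟩
  n               ∎
  where open ≤-Reasoning

odd⇒[m+m≤n⇒m+m≤n∸1] : ∀ {m n} → n % 2 ≡ 1 → m + m ≤ n → m + m ≤ n ∸ 1
odd⇒[m+m≤n⇒m+m≤n∸1] {m} {n} odd m+m≤n = begin
  m + m   ≤⟨ +-mono-≤ m≤k m≤k ⟩
  k + k   ≡⟨ cong (_∸ 1) (≡.sym n≡1+k+k) ⟩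
  n ∸ 1   ∎
  where
  open ≤-Reasoning
  k : ℕ
  k = ⌊ n /2⌋
  n≡1+k+k : n ≡ suc (k + k)
  n≡1+k+k = odd⇒≡1+⌊n/2⌋+⌊n/2⌋ n odd
  m≤k : m ≤ k
  m≤k = m+m≤1+n+n⇒m≤n m k (subst (m + m ≤_) n≡1+k+k m+m≤n)

m+m+n≤1+n⇒m≡0 : ∀ m n → m + m + n ≤ suc n → m ≡ 0
m+m+n≤1+n⇒m≡0 zero    n _           = refl
m+m+n≤1+n⇒m≡0 (suc m) n (s≤s m+m+n≤) =
  contradiction m+m+n≤ (<⇒≱ (m<n+m n (subst (0 <_) (≡.sym (+-suc m m)) z<s)))

Unique⇒length≤∣p∣ : ∀ {n} {p : Subset n} {xs : List (Fin n)} → Unique xs → All (_∈ p) xs → length xs ≤ ∣ p ∣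
Unique⇒length≤∣p∣ {xs = []}    _              _           = z≤n
Unique⇒length≤∣p∣ {p = p} {x ∷ xs} (x∉xs ∷ uniq) (x∈p ∷ xs⊆p) =
  ≤-<-trans (Unique⇒length≤∣p∣ uniq xs⊆p-x) (x∈p⇒∣p-x∣<∣p∣ x∈p)
  where
  xs⊆p-x : All (_∈ p - x) xs
  xs⊆p-x = All.zipWith (λ (x≢y , y∈p) → x∈p∧x≢y⇒x∈p-y y∈p (x≢y ∘ ≡.sym)) (x∉xs , xs⊆p)

length-verts : ∀ {n} (M : EdgeList n) → length (verts M) ≡ length M + length M
length-verts []            = refl
length-verts ((u , v) ∷ M) =
  cong suc (trans (cong suc (length-verts M)) (≡.sym (+-suc (length M) (length M))))

matched≤∣R∣ : ∀ {n} (R : Subset n) (M : EdgeList n) → Unique (verts M) → matched R M ≤ ∣ R ∣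
matched≤∣R∣ R M uniq = Unique⇒length≤∣p∣ (Unique.filter⁺ (_∈? R) uniq) (all-filter (_∈? R) (verts M))

matched≤∣M∣+∣M∣ : ∀ {n} (R : Subset n) (M : EdgeList n) → matched R M ≤ length M + length M
matched≤∣M∣+∣M∣ R M = subst (matched R M ≤_) (length-verts M) (length-filter (_∈? R) (verts M))

∣M∣+∣M∣≤n : ∀ {n} (M : EdgeList n) → Unique (verts M) → length M + length M ≤ n
∣M∣+∣M∣≤n {n} M uniq = begin
  length M + length M  ≡⟨ ≡.sym (length-verts M) ⟩
  length (verts M)     ≤⟨ Unique⇒length≤∣p∣ uniq (All.tabulate (λ _ → ∈⊤)) ⟩
  ∣ ⊤ {n} ∣             ≡⟨ ∣⊤∣≡n n ⟩
  n                    ∎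
  where open ≤-Reasoning

odd⇒matched≤n∸1 : ∀ {n} (R : Subset n) (M : EdgeList n) → n % 2 ≡ 1 → Unique (verts M)
  → matched R M ≤ n ∸ 1
odd⇒matched≤n∸1 R M odd uniq =
  ≤-trans (matched≤∣M∣+∣M∣ R M) (odd⇒[m+m≤n⇒m+m≤n∸1] {length M} odd (∣M∣+∣M∣≤n M uniq))

add-edge : ∀ {x y L} → x ≤ L + L → y ≤ 2 + x → y ≤ suc L + suc L
add-edge {L = L} x≤L+L y≤2+x =
  ≤-trans y≤2+x (≤-trans (s≤s (s≤s x≤L+L)) (≤-reflexive (cong suc (≡.sym (+-suc L L)))))

∣free∣+∣free∣+matched≤∣M∣+∣M∣ : ∀ {n} (R : Subset n) (M : EdgeList n) →
  length (freeEdges R M) + length (freeEdges R M) + matched R M ≤ length M + length M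
∣free∣+∣free∣+matched≤∣M∣+∣M∣ R [] = z≤n
∣free∣+∣free∣+matched≤∣M∣+∣M∣ R ((u , v) ∷ M)
  -- Nested, not simultaneous: the test on v only surfaces once the one on u has reduced filter.
  with ih ← ∣free∣+∣free∣+matched≤∣M∣+∣M∣ R M | does (u ∈? R)
... | true with does (v ∈? R)
...   | true  = add-edge ih (≤-reflexive (trans (+-suc _ _) (cong suc (+-suc _ _))))
...   | false = add-edge ih (≤-trans (≤-reflexive (+-suc _ _)) (n≤1+n _))
∣free∣+∣free∣+matched≤∣M∣+∣M∣ R ((u , v) ∷ M) | false with does (v ∈? R)
...   | true  = add-edge ih (≤-trans (≤-reflexive (+-suc _ _)) (n≤1+n _))
...   | false = add-edge ih (≤-reflexive (cong (λ k → suc k + matched R M) (+-suc f f)))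
  where
  f : ℕ
  f = length (freeEdges R M)

∣M∣+∣M∣≤1+matched⇒∣free∣≡0 : ∀ {n} (R : Subset n) (M : EdgeList n) →
  length M + length M ≤ suc (matched R M) → length (freeEdges R M) ≡ 0
∣M∣+∣M∣≤1+matched⇒∣free∣≡0 R M ∣M∣+∣M∣≤ = m+m+n≤1+n⇒m≡0 _ (matched R M)
  (≤-trans (∣free∣+∣free∣+matched≤∣M∣+∣M∣ R M) ∣M∣+∣M∣≤)

isBeta∧isCanonical : ∀ {n} (G : Graph n) (R : Subset n) M b → IsMPD G M → matched R M ≡ b
  → (∀ M′ → IsMPD G M′ → matched R M′ ≤ b)
  → length M + length M ≤ suc b
  → IsBeta G R b × IsCanonical G R M
isBeta∧isCanonical G R M _ mpd refl bound short =
  ((M , mpd , refl) , bound) , ((mpd , bound) , fewest-free)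
  where
  fewest-free : ∀ M′ → IsMaxMPD G R M′ → length (freeEdges R M) ≤ length (freeEdges R M′)
  fewest-free _ _ rewrite ∣M∣+∣M∣≤1+matched⇒∣free∣≡0 R M short = z≤n

lemma2 : ∀ {n} (G : Graph n) (R : Subset n) (M : EdgeList n)
    → NoIsolated G → IsMPD G M
    → ((matched R M ≡ ∣ R ∣ → length M ≡ ⌈ ∣ R ∣ /2⌉
          → IsBeta G R ∣ R ∣ × IsCanonical G R M)
      × (n ≡ ∣ R ∣ → ∣ R ∣ % 2 ≡ 1 → matched R M ≡ ∣ R ∣ ∸ 1 → length M ≡ ⌊ ∣ R ∣ /2⌋
          → IsBeta G R (∣ R ∣ ∸ 1) × IsCanonical G R M))
-- NoIsolated G only guarantees that some MPD exists; here M is given.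
lemma2 {n} G R M _ mpd = all-matched , all-but-one-matched
  where
  all-matched : matched R M ≡ ∣ R ∣ → length M ≡ ⌈ ∣ R ∣ /2⌉
    → IsBeta G R ∣ R ∣ × IsCanonical G R M
  all-matched hm hl = isBeta∧isCanonical G R M ∣ R ∣ mpd hm
    (λ M′ (_ , uniq , _) → matched≤∣R∣ R M′ uniq)
    (subst (λ L → L + L ≤ suc ∣ R ∣) (≡.sym hl) (⌈n/2⌉+⌈n/2⌉≤1+n ∣ R ∣))

  all-but-one-matched : n ≡ ∣ R ∣ → ∣ R ∣ % 2 ≡ 1 → matched R M ≡ ∣ R ∣ ∸ 1 → length M ≡ ⌊ ∣ R ∣ /2⌋
    → IsBeta G R (∣ R ∣ ∸ 1) × IsCanonical G R M
  all-but-one-matched hn odd hm hl = isBeta∧isCanonical G R M (∣ R ∣ ∸ 1) mpd hm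
    (λ M′ (_ , uniq , _) → subst (λ N → matched R M′ ≤ N ∸ 1) hn
      (odd⇒matched≤n∸1 R M′ (subst (λ N → N % 2 ≡ 1) (≡.sym hn) odd) uniq))
    (subst (λ L → L + L ≤ suc (∣ R ∣ ∸ 1)) (≡.sym hl)
      (≤-trans (⌊n/2⌋+⌊n/2⌋≤n ∣ R ∣) (m≤n+m∸n ∣ R ∣ 1)))
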